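{- Let $G$ be a finite abelian group, $S=\{s,-s,s',-s',s_0\}\subseteq G\setminus\{0\}$ a generating set of $G$ with $|S|=5$, $o(s_0)=2$ and $o(s),o(s')>2$, and $\Gamma=\mathrm{Cay}(G,S)$. For integers $i,j,k$ let $x(i,j,k)=is+js'+ks_0$. Let $a\in\{ -1,1\}$ and let $h,l$ be integers with $0\le h\le o(s)$, $0\le l\le o(s')$ and $x(0,0,0)=x(h,l,0)$. Let $D$ be a perfect code of $\Gamma$ such that $x(i+a,j+1,k+1)\in D$ for all $x(i,j,k)\in D$. Then $3\mid(l-ah)$. Moreover, if $\sigma(h)=\sigma(l)=0$, then $\sigma(o(s))>\sigma(l-ah)$ and $\sigma(o(s'))>\sigma(l-ah)$.
   Context: $\mathrm{Cay}(G,S)$ has vertex set $G$ with $x\sim y$ iff $y-x\in S$. A perfect code is a vertex set $C$ such that every vertex is at distance at most $1$ from exactly one vertex of $C$. $o(x)$ is the order of $x$. For an integer $n$, $\sigma(n)$ is the largest nonnegative integer $i$ with $2^i\mid n$ ($\sigma(0)=+\infty$). -}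

module Defs where

open import Level using (0ℓ)
open import Algebra.Bundles using (AbelianGroup)
open import Data.Nat as ℕ using (ℕ; zero; suc)
open import Data.Nat.DivMod using (_/_; _%_)
open import Data.Integer as ℤ using (ℤ; +_; -[1+_]; ∣_∣)
open import Data.Fin using (Fin)
open import Data.Product using (Σ; ∃; _×_; _,_)
open import Relation.Nullary using (¬_; yes; no)
open import Relation.Binary.PropositionalEquality using (_≡_)
open import Data.Empty using (⊥)
open import Data.Unit using (⊤)

-- ℕ extended with +∞ (for the 2-adic valuation σ with σ(0) = +∞)
data ℕ∞ : Set where
  fin : ℕ → ℕ∞
  ∞   : ℕ∞

suc∞ : ℕ∞ → ℕ∞
suc∞ (fin n) = fin (suc n)
suc∞ ∞ = ∞

_<∞_ : ℕ∞ → ℕ∞ → Set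
fin m <∞ fin n = m ℕ.< n
fin m <∞ ∞     = ⊤
∞     <∞ _     = ⊥

-- σ on naturals; first argument is fuel (fuel ≥ n suffices)
σℕ : ℕ → ℕ → ℕ∞
σℕ _       zero    = ∞
σℕ zero    (suc n) = fin 0
σℕ (suc f) (suc n) with (suc n) % 2 ℕ.≟ 0
... | yes _ = suc∞ (σℕ f (suc n / 2))
... | no  _ = fin 0

-- σ(n): largest i with 2^i ∣ n; σ(0) = ∞
σ : ℤ → ℕ∞
σ z = σℕ ∣ z ∣ ∣ z ∣

module _ (G : AbelianGroup 0ℓ 0ℓ) where
  open AbelianGroup G

  _×ℕ_ : ℕ → Carrier → Carrier
  zero  ×ℕ x = ε
  suc n ×ℕ x = x ∙ (n ×ℕ x)

  _·_ : ℤ → Carrier → Carrier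
  (+ n)    · x = n ×ℕ x
  -[1+ n ] · x = (suc n ×ℕ x) ⁻¹

  IsFinite : Set
  IsFinite = Σ ℕ λ n → Σ (Fin n → Carrier) λ f → ∀ g → ∃ λ i → f i ≈ g

  IsOrder : Carrier → ℕ → Set
  IsOrder x n = (0 ℕ.< n) × (n ×ℕ x ≈ ε) × (∀ m → 0 ℕ.< m → m ℕ.< n → ¬ (m ×ℕ x ≈ ε))

  xv : Carrier → Carrier → Carrier → ℤ → ℤ → ℤ → Carrier
  xv s s' s₀ i j k = (i · s) ∙ (j · s') ∙ (k · s₀)

  InS : Carrier → Carrier → Carrier → Carrier → Set
  InS s s' s₀ g = (g ≈ s) Data.Sum.⊎ ((g ≈ s ⁻¹) Data.Sum.⊎ ((g ≈ s') Data.Sum.⊎ ((g ≈ s' ⁻¹) Data.Sum.⊎ (g ≈ s₀))))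
    where import Data.Sum

  -- S generates G (G abelian: every element is a ℤ-combination of elements of S)
  Generates : Carrier → Carrier → Carrier → Set
  Generates s s' s₀ = ∀ g → ∃ λ i → ∃ λ j → ∃ λ k → g ≈ xv s s' s₀ i j k

  -- distance ≤ 1 in Cay(G,S): v = c or v - c ∈ S
  Close : Carrier → Carrier → Carrier → Carrier → Carrier → Set
  Close s s' s₀ v c = (v ≈ c) Data.Sum.⊎ InS s s' s₀ (v ∙ c ⁻¹)
    where import Data.Sum

  IsPerfectCode : Carrier → Carrier → Carrier → (Carrier → Set) → Set
  IsPerfectCode s s' s₀ D =
    ∀ v → (∃ λ c → D c × Close s s' s₀ v c)
        × (∀ c c' → D c → Close s s' s₀ v c → D c' → Close s s' s₀ v c' → c ≈ c')

  RespectsEq : (Carrier → Set) → Set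
  RespectsEq D = ∀ {x y} → x ≈ y → D x → D y

module _ (G : AbelianGroup 0ℓ 0ℓ) where
  open AbelianGroup G
  El : Set
  El = Carrier
  Eq : Carrier → Carrier → Set
  Eq = _≈_
  neg : Carrier → Carrier
  neg = _⁻¹
  zer : Carrier
  zer = ε

-- Pull D back along φ(i,j,k) = i s + j s' + k s₀ to a subset P of ℤ³. The hypothesis makes
-- τ = (a,1,1) a period of P (the reverse inclusion follows from perfectness), hence so is
-- υ = aτ = (1,a,a); every vector in the kernel of φ, such as (0,0,2), (h,l,0), (o(s),0,0)
-- and (0,o(s'),0), is a period as well. Modulo υ every point moves into the plane i = 0
-- keeping its column j - a i. The closed neighbourhood of a point in column x + 2 meets P,
-- so one of the columns x + 1, x + 2, x + 3 is occupied, whereas occupied columns at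
-- distance 1 or 2 would put two codewords into one closed neighbourhood. So occupied
-- columns are spaced by multiples of 3, and the period (h,l,0) shifts columns by l - a h.
-- If moreover h, l are odd, o(s) = 2^e A with A odd and 2^e divides l - a h, then an integer
-- combination of (h,l,0) and (o(s),0,0) is a period of column 0 and odd height; reducing it
-- by υ and (0,0,2) makes (0,0,1) a period, i.e. two codewords differ by s₀. Likewise for o(s').

{-# OPTIONS --safe #-}
module Submission where

open import Defs hiding (_·_)
open import Level using (0ℓ)
open import Algebra.Bundles using (AbelianGroup)
open import Data.Empty using (⊥)
open import Data.Integer using (ℤ; +_; -[1+_]; -_; _+_; _-_; _*_; ∣_∣)
open import Data.Integer.DivMod using (_%ℕ_; _/ℕ_; a≡a%ℕn+[a/ℕn]*n; n%ℕd<d)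
open import Data.Integer.Divisibility using (_∣_)
import Data.Integer.Divisibility.Signed as Signed
open Signed using (divides; ∣ᵤ⇒∣; ∣⇒∣ᵤ; ∣-refl; ∣m∣n⇒∣m+n; ∣m⇒∣-m)
import Data.Integer.Properties as ℤ
open import Data.Integer.Tactic.RingSolver using (solve-∀)
import Data.Nat
open import Data.Nat as ℕ using (ℕ; zero; suc; _^_; s≤s; _≤_)
open import Data.Nat.DivMod using (_/_; _%_; m≡m%n+[m/n]*n; m%n<n)
import Data.Nat.Divisibility as ℕD
import Data.Nat.Properties as ℕ
open import Data.Product using (∃; ∃₂; _×_; _,_; proj₁; proj₂)
open import Data.Sum using (_⊎_; inj₁; inj₂)
open import Function using (_∘_)
open import Function.Bundles using (_⇔_; mk⇔; Equivalence)
open import Function.Properties.Equivalence using (⇔-setoid)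
open import Relation.Nullary using (¬_; Dec; yes; no; contradiction)
open import Relation.Binary.PropositionalEquality using (_≡_; _≢_; refl; sym; trans; cong; cong₂; subst; module ≡-Reasoning)
import Relation.Binary.Reasoning.Setoid

Odd : ℤ → Set
Odd z = ∃ λ r → z ≡ + 1 + (r + r)

odd-neg : ∀ {x} → Odd x → Odd (- x)
odd-neg (r , refl) = - r - + 1 , negate r
  where
  negate : ∀ r → - (+ 1 + (r + r)) ≡ + 1 + ((- r - + 1) + (- r - + 1))
  negate = solve-∀

±1-odd : ∀ {a} → a ≡ + 1 ⊎ a ≡ - + 1 → Odd a
±1-odd (inj₁ refl) = + 0 , refl
±1-odd (inj₂ refl) = - + 1 , refl

odd-* : ∀ {x y} → Odd x → Odd y → Odd (x * y)
odd-* (r , refl) (t , refl) = r + t + (r * t + r * t) , expand r t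
  where
  expand : ∀ r t → (+ 1 + (r + r)) * (+ 1 + (t + t)) ≡ + 1 + ((r + t + (r * t + r * t)) + (r + t + (r * t + r * t)))
  expand = solve-∀

parity : ∀ z → ∃ λ r → z ≡ r + r ⊎ z ≡ + 1 + (r + r)
parity z with z %ℕ 2 | a≡a%ℕn+[a/ℕn]*n z 2 | n%ℕd<d z 2
... | 0           | z≡ | _ = z /ℕ 2 , inj₁ (trans z≡ (double (z /ℕ 2)))
  where
  double : ∀ q → + 0 + q * + 2 ≡ q + q
  double = solve-∀
... | 1           | z≡ | _ = z /ℕ 2 , inj₂ (trans z≡ (double+1 (z /ℕ 2)))
  where
  double+1 : ∀ q → + 1 + q * + 2 ≡ + 1 + (q + q)
  double+1 = solve-∀
... | suc (suc _) | _  | s≤s (s≤s ())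

%2≢0⇒odd : ∀ m → m % 2 ≢ 0 → Odd (+ m)
%2≢0⇒odd m m%2≢0 = + (m / 2) , cong +_ (trans (m≡m%n+[m/n]*n m 2) (cong₂ ℕ._+_ rem≡1 (double (m / 2))))
  where
  double : ∀ q → q ℕ.* 2 ≡ q ℕ.+ q
  double q = trans (ℕ.*-suc q 1) (cong (q ℕ.+_) (ℕ.*-identityʳ q))
  rem≡1 : m % 2 ≡ 1
  rem≡1 with m % 2 | m%n<n m 2
  ... | 0 | _ = contradiction refl m%2≢0
  ... | 1 | _ = refl
  ... | suc (suc _) | s≤s (s≤s ())

σℕ-spec : ∀ f n → n ℕ.< f →
  ∃₂ λ e A → σℕ f (suc n) ≡ fin e × suc n ≡ 2 ^ e ℕ.* A × Odd (+ A)
σℕ-spec (suc f) n (s≤s n≤f) with suc n % 2 ℕ.≟ 0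
... | yes rem≡0 = halve (suc n / 2) (trans (m≡m%n+[m/n]*n (suc n) 2) (cong (ℕ._+ suc n / 2 ℕ.* 2) rem≡0))
  where
  halve : ∀ k → suc n ≡ k ℕ.* 2 →
    ∃₂ λ e A → suc∞ (σℕ f k) ≡ fin e × suc n ≡ 2 ^ e ℕ.* A × Odd (+ A)
  halve zero    ()
  halve (suc k) n≡2k with σℕ-spec f k (ℕ.≤-trans (s≤s (ℕ.m≤m*n k 2)) (subst (ℕ._≤ f) (ℕ.suc-injective n≡2k) n≤f))
  ... | e , A , σ≡e , k≡ , odd = suc e , A , cong suc∞ σ≡e , trans n≡2k (trans (cong (ℕ._* 2) k≡) (twice e A)) , odd
    where
    twice : ∀ e A → (2 ^ e ℕ.* A) ℕ.* 2 ≡ 2 ^ suc e ℕ.* A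
    twice e A = trans (ℕ.*-comm (2 ^ e ℕ.* A) 2) (sym (ℕ.*-assoc 2 (2 ^ e) A))
... | no rem≢0 = 0 , suc n , refl , sym (ℕ.*-identityˡ (suc n)) , %2≢0⇒odd (suc n) rem≢0

σ-spec : ∀ z → z ≢ + 0 → ∃₂ λ e A → σ z ≡ fin e × ∣ z ∣ ≡ 2 ^ e ℕ.* A × Odd (+ A)
σ-spec (+ zero)  z≢0 = contradiction refl z≢0
σ-spec (+ suc n) _   = σℕ-spec (suc n) n ℕ.≤-refl
σ-spec -[1+ n ]  _   = σℕ-spec (suc n) n ℕ.≤-refl

σ≡0⇒odd : ∀ n → σ (+ n) ≡ fin 0 → Odd (+ n)
σ≡0⇒odd zero    ()
σ≡0⇒odd (suc n) σ≡0 with σ-spec (+ suc n) (λ ())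
... | e , A , σ≡e , n≡ , odd with trans (sym σ≡e) σ≡0
... | refl = subst (Odd ∘ +_) (sym (trans n≡ (ℕ.*-identityˡ A))) odd

∤⇒σ<∞ : ∀ z e → ¬ (+ (2 ^ e) Signed.∣ z) → σ z <∞ fin e
∤⇒σ<∞ z e 2^e∤z with z ℤ.≟ + 0
... | yes refl = contradiction (divides (+ 0) refl) 2^e∤z
... | no z≢0 with σ-spec z z≢0
...   | f , A , σ≡f , ∣z∣≡ , _ = subst (_<∞ fin e) (sym σ≡f) (f<e (f ℕ.<? e))
  where
  f<e : Dec (f ℕ.< e) → f ℕ.< e
  f<e (yes f<e) = f<e
  f<e (no f≮e) = contradiction (∣ᵤ⇒∣ (subst (2 ^ e ℕD.∣_) (sym ∣z∣≡) 2^e∣2^f*A)) 2^e∤z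
    where
    2^f≡ : 2 ^ f ≡ 2 ^ e ℕ.* 2 ^ (f ℕ.∸ e)
    2^f≡ = trans (cong (2 ^_) (sym (ℕ.m+[n∸m]≡n (ℕ.≮⇒≥ f≮e)))) (ℕ.^-distribˡ-+-* 2 e (f ℕ.∸ e))
    2^e∣2^f*A : 2 ^ e ℕD.∣ 2 ^ f ℕ.* A
    2^e∣2^f*A = subst (λ x → 2 ^ e ℕD.∣ x ℕ.* A) (sym 2^f≡) (ℕD.∣m⇒∣m*n A (ℕD.m∣m*n (2 ^ (f ℕ.∸ e))))

∤⇒σ<∞σ : ∀ z o → 0 ℕ.< o →
  (∀ e A → o ≡ 2 ^ e ℕ.* A → Odd (+ A) → ¬ (+ (2 ^ e) Signed.∣ z)) → σ z <∞ σ (+ o)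
∤⇒σ<∞σ z (suc o) _ 2^e∤z with σ-spec (+ suc o) (λ ())
... | e , A , σ≡e , o≡ , odd = subst (σ z <∞_) (sym σ≡e) (∤⇒σ<∞ z e (2^e∤z e A o≡ odd))

module _ (O : ℤ → Set)
  (gap₁ : ∀ x → O x → ¬ O (x + + 1))
  (gap₂ : ∀ x → O x → ¬ O (x + + 2))
  (cover : ∀ x → O (x + + 1) ⊎ O (x + + 2) ⊎ O (x + + 3))
  where

  private
    O+3 : ∀ x → O x → O (x + + 3)
    O+3 x o with cover x
    ... | inj₁ o₁        = contradiction o₁ (gap₁ x o)
    ... | inj₂ (inj₁ o₂) = contradiction o₂ (gap₂ x o)
    ... | inj₂ (inj₂ o₃) = o₃

    spacing-+ : ∀ n x → O x → O (x + + n) → + 3 Signed.∣ + n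
    spacing-+ 0                 x o o' = divides (+ 0) refl
    spacing-+ 1                 x o o' = contradiction o' (gap₁ x o)
    spacing-+ 2                 x o o' = contradiction o' (gap₂ x o)
    spacing-+ (suc (suc (suc n))) x o o' =
      ∣m∣n⇒∣m+n ∣-refl (spacing-+ n (x + + 3) (O+3 x o) (subst O (sym (ℤ.+-assoc x (+ 3) (+ n))) o'))

  mod3-spacing : ∀ x d → O x → O (x + d) → + 3 Signed.∣ d
  mod3-spacing x (+ n)    o o' = spacing-+ n x o o'
  mod3-spacing x -[1+ n ] o o' = ∣m⇒∣-m (spacing-+ (suc n) (x + -[1+ n ]) o' (subst O (x≡x-k+k x (+ suc n)) o))
    where
    x≡x-k+k : ∀ x k → x ≡ x + - k + k
    x≡x-k+k = solve-∀

module IntegerMultiples (G : AbelianGroup 0ℓ 0ℓ) where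
  open AbelianGroup G renaming (refl to ≈-refl; sym to ≈-sym; trans to ≈-trans)
  open import Algebra.Properties.AbelianGroup G using (⁻¹-∙-comm)
  open import Relation.Binary.Reasoning.Setoid setoid

  infixr 8 _·_
  _·_ : ℤ → Carrier → Carrier
  _·_ = Defs._·_ G

  private
    ·-cong-≡ : ∀ {i j} x → i ≡ j → i · x ≈ j · x
    ·-cong-≡ x i≡j = reflexive (cong (_· x) i≡j)

    ·-suc : ∀ j x → (+ 1 + j) · x ≈ x ∙ j · x
    ·-suc (+ n)          x = ≈-refl
    ·-suc -[1+ zero ]    x = begin
      ε                ≈⟨ inverseʳ x ⟨
      x ∙ x ⁻¹         ≈⟨ ∙-congˡ (⁻¹-cong (identityʳ x)) ⟨
      x ∙ (x ∙ ε) ⁻¹   ∎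
    ·-suc -[1+ suc n ] x = begin
      -[1+ n ] · x                   ≈⟨ identityˡ _ ⟨
      ε ∙ -[1+ n ] · x               ≈⟨ ∙-congʳ (inverseʳ x) ⟨
      (x ∙ x ⁻¹) ∙ -[1+ n ] · x      ≈⟨ assoc _ _ _ ⟩
      x ∙ (x ⁻¹ ∙ -[1+ n ] · x)      ≈⟨ ∙-congˡ (⁻¹-∙-comm _ _) ⟩
      x ∙ -[1+ suc n ] · x           ∎

    ·-pred : ∀ j x → (-[1+ 0 ] + j) · x ≈ x ⁻¹ ∙ j · x
    ·-pred (+ zero)   x = ≈-trans (⁻¹-cong (identityʳ x)) (≈-sym (identityʳ _))
    ·-pred (+ suc n)  x = begin
      (+ n) · x                ≈⟨ identityˡ _ ⟨
      ε ∙ (+ n) · x            ≈⟨ ∙-congʳ (inverseˡ x) ⟨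
      (x ⁻¹ ∙ x) ∙ (+ n) · x   ≈⟨ assoc _ _ _ ⟩
      x ⁻¹ ∙ (+ suc n) · x     ∎
    ·-pred -[1+ n ]   x = ≈-sym (⁻¹-∙-comm _ _)

  ·-homo-+ : ∀ i j x → (i + j) · x ≈ i · x ∙ j · x
  ·-homo-+ (+ zero)        j x = ≈-trans (·-cong-≡ x (ℤ.+-identityˡ j)) (≈-sym (identityˡ _))
  ·-homo-+ (+ suc n)       j x = begin
    (+ suc n + j) · x             ≈⟨ ·-cong-≡ x (ℤ.+-assoc (+ 1) (+ n) j) ⟩
    (+ 1 + (+ n + j)) · x         ≈⟨ ·-suc (+ n + j) x ⟩
    x ∙ (+ n + j) · x             ≈⟨ ∙-congˡ (·-homo-+ (+ n) j x) ⟩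
    x ∙ ((+ n) · x ∙ j · x)       ≈⟨ assoc _ _ _ ⟨
    (+ suc n) · x ∙ j · x         ∎
  ·-homo-+ -[1+ zero ]     j x = ≈-trans (·-pred j x) (∙-congʳ (⁻¹-cong (≈-sym (identityʳ x))))
  ·-homo-+ -[1+ suc n ]    j x = begin
    (-[1+ suc n ] + j) · x              ≈⟨ ·-cong-≡ x (ℤ.+-assoc -[1+ 0 ] -[1+ n ] j) ⟩
    (-[1+ 0 ] + (-[1+ n ] + j)) · x     ≈⟨ ·-pred (-[1+ n ] + j) x ⟩
    x ⁻¹ ∙ (-[1+ n ] + j) · x           ≈⟨ ∙-congˡ (·-homo-+ -[1+ n ] j x) ⟩
    x ⁻¹ ∙ (-[1+ n ] · x ∙ j · x)       ≈⟨ assoc _ _ _ ⟨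
    (x ⁻¹ ∙ -[1+ n ] · x) ∙ j · x       ≈⟨ ∙-congʳ (·-pred -[1+ n ] x) ⟨
    -[1+ suc n ] · x ∙ j · x            ∎

ℤ³ : Set
ℤ³ = ℤ × ℤ × ℤ

infixl 6 _⊕_
infixr 7 _⊙_

_⊕_ : ℤ³ → ℤ³ → ℤ³
(i , j , k) ⊕ (i' , j' , k') = (i + i' , j + j' , k + k')

_⊙_ : ℤ → ℤ³ → ℤ³
n ⊙ (i , j , k) = (n * i , n * j , n * k)

triple-≡ : ∀ {i j k i' j' k' : ℤ} → i ≡ i' → j ≡ j' → k ≡ k' → (i , j , k) ≡ (i' , j' , k')
triple-≡ refl refl refl = refl

⊕-assoc : ∀ u v w → u ⊕ v ⊕ w ≡ u ⊕ (v ⊕ w)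
⊕-assoc (i , j , k) (i' , j' , k') (i'' , j'' , k'') =
  triple-≡ (ℤ.+-assoc i i' i'') (ℤ.+-assoc j j' j'') (ℤ.+-assoc k k' k'')

⊕-identityʳ : ∀ v → v ⊕ (+ 0 , + 0 , + 0) ≡ v
⊕-identityʳ (i , j , k) = triple-≡ (ℤ.+-identityʳ i) (ℤ.+-identityʳ j) (ℤ.+-identityʳ k)

⊙-suc : ∀ n v → + suc n ⊙ v ≡ v ⊕ + n ⊙ v
⊙-suc n (i , j , k) = triple-≡ (ℤ.suc-* (+ n) i) (ℤ.suc-* (+ n) j) (ℤ.suc-* (+ n) k)

⊕-⊙-neg-cancel : ∀ w n v → w ⊕ (- n) ⊙ v ⊕ n ⊙ v ≡ w
⊕-⊙-neg-cancel (i , j , k) n (x , y , z) = triple-≡ (cancel i n x) (cancel j n y) (cancel k n z)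
  where
  cancel : ∀ a n x → a + - n * x + n * x ≡ a
  cancel = solve-∀

data Move : Set where
  stay +s -s +s' -s' +s₀ : Move

vec : Move → ℤ³
vec stay = (+ 0 , + 0 , + 0)
vec +s   = (+ 1 , + 0 , + 0)
vec -s   = (- + 1 , + 0 , + 0)
vec +s'  = (+ 0 , + 1 , + 0)
vec -s'  = (+ 0 , - + 1 , + 0)
vec +s₀  = (+ 0 , + 0 , + 1)

move : Move → ℤ³ → ℤ³
move stay v           = v
move +s  (i , j , k)  = (i + + 1 , j , k)
move -s  (i , j , k)  = (i - + 1 , j , k)
move +s' (i , j , k)  = (i , j + + 1 , k)
move -s' (i , j , k)  = (i , j - + 1 , k)
move +s₀ (i , j , k)  = (i , j , k + + 1)

move≡⊕vec : ∀ m v → move m v ≡ v ⊕ vec m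
move≡⊕vec stay (i , j , k) = triple-≡ (sym (ℤ.+-identityʳ i)) (sym (ℤ.+-identityʳ j)) (sym (ℤ.+-identityʳ k))
move≡⊕vec +s   (i , j , k) = triple-≡ refl (sym (ℤ.+-identityʳ j)) (sym (ℤ.+-identityʳ k))
move≡⊕vec -s   (i , j , k) = triple-≡ refl (sym (ℤ.+-identityʳ j)) (sym (ℤ.+-identityʳ k))
move≡⊕vec +s'  (i , j , k) = triple-≡ (sym (ℤ.+-identityʳ i)) refl (sym (ℤ.+-identityʳ k))
move≡⊕vec -s'  (i , j , k) = triple-≡ (sym (ℤ.+-identityʳ i)) refl (sym (ℤ.+-identityʳ k))
move≡⊕vec +s₀  (i , j , k) = triple-≡ (sym (ℤ.+-identityʳ i)) (sym (ℤ.+-identityʳ j)) refl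

⊕-swap : ∀ u v w → u ⊕ v ⊕ w ≡ u ⊕ w ⊕ v
⊕-swap (i , j , k) (i' , j' , k') (i'' , j'' , k'') = triple-≡ (swap i i' i'') (swap j j' j'') (swap k k' k'')
  where
  swap : ∀ x y z → x + y + z ≡ x + z + y
  swap = solve-∀

move-⊕ : ∀ m v w → move m v ⊕ w ≡ move m (v ⊕ w)
move-⊕ m v w = begin
  move m v ⊕ w        ≡⟨ cong (_⊕ w) (move≡⊕vec m v) ⟩
  v ⊕ vec m ⊕ w       ≡⟨ ⊕-swap v (vec m) w ⟩
  v ⊕ w ⊕ vec m       ≡⟨ move≡⊕vec m (v ⊕ w) ⟨
  move m (v ⊕ w)      ∎
  where open ≡-Reasoning

module Coordinates (G : AbelianGroup 0ℓ 0ℓ) (s s' s₀ : AbelianGroup.Carrier G) where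
  open AbelianGroup G renaming (refl to ≈-refl; sym to ≈-sym; trans to ≈-trans)
  open import Algebra.Properties.CommutativeSemigroup commutativeSemigroup using (interchange)
  open import Relation.Binary.Reasoning.Setoid setoid
  open IntegerMultiples G

  φ : ℤ³ → Carrier
  φ (i , j , k) = xv G s s' s₀ i j k

  φ-homo : ∀ v w → φ (v ⊕ w) ≈ φ v ∙ φ w
  φ-homo (i , j , k) (i' , j' , k') = begin
    ((i + i') · s ∙ (j + j') · s') ∙ (k + k') · s₀
      ≈⟨ ∙-cong (∙-cong (·-homo-+ i i' s) (·-homo-+ j j' s')) (·-homo-+ k k' s₀) ⟩
    ((i · s ∙ i' · s) ∙ (j · s' ∙ j' · s')) ∙ (k · s₀ ∙ k' · s₀)
      ≈⟨ ∙-congʳ (interchange _ _ _ _) ⟩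
    ((i · s ∙ j · s') ∙ (i' · s ∙ j' · s')) ∙ (k · s₀ ∙ k' · s₀)
      ≈⟨ interchange _ _ _ _ ⟩
    ((i · s ∙ j · s') ∙ k · s₀) ∙ ((i' · s ∙ j' · s') ∙ k' · s₀) ∎

  step : Move → Carrier
  step stay = ε
  step +s   = s
  step -s   = s ⁻¹
  step +s'  = s'
  step -s'  = s' ⁻¹
  step +s₀  = s₀

  φ-vec : ∀ m → φ (vec m) ≈ step m
  φ-vec stay = ≈-trans (identityʳ _) (identityʳ ε)
  φ-vec +s   = ≈-trans (identityʳ _) (≈-trans (identityʳ _) (identityʳ s))
  φ-vec -s   = ≈-trans (identityʳ _) (≈-trans (identityʳ _) (⁻¹-cong (identityʳ s)))
  φ-vec +s'  = ≈-trans (identityʳ _) (≈-trans (identityˡ _) (identityʳ s'))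
  φ-vec -s'  = ≈-trans (identityʳ _) (≈-trans (identityˡ _) (⁻¹-cong (identityʳ s')))
  φ-vec +s₀  = ≈-trans (∙-congʳ (identityʳ ε)) (≈-trans (identityˡ _) (identityʳ s₀))

  φ-move : ∀ m v → φ (move m v) ≈ φ v ∙ step m
  φ-move m v = begin
    φ (move m v)      ≡⟨ cong φ (move≡⊕vec m v) ⟩
    φ (v ⊕ vec m)     ≈⟨ φ-homo v (vec m) ⟩
    φ v ∙ φ (vec m)   ≈⟨ ∙-congˡ (φ-vec m) ⟩
    φ v ∙ step m      ∎

module ⇔-Reasoning = Relation.Binary.Reasoning.Setoid (⇔-setoid 0ℓ)

module PerfectCode (G : AbelianGroup 0ℓ 0ℓ) (s s' s₀ : AbelianGroup.Carrier G)
  (s₀-order-2 : AbelianGroup._≈_ G (_×ℕ_ G 2 s₀) (AbelianGroup.ε G))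
  (D : AbelianGroup.Carrier G → Set) (D-resp : RespectsEq G D) (perfect : IsPerfectCode G s s' s₀ D)
  where
  open AbelianGroup G renaming (refl to ≈-refl; sym to ≈-sym; trans to ≈-trans)
  open import Algebra.Properties.AbelianGroup G
  module ≈-Reasoning = Relation.Binary.Reasoning.Setoid setoid
  open Coordinates G s s' s₀ public

  s₀⁻¹≈s₀ : s₀ ⁻¹ ≈ s₀
  s₀⁻¹≈s₀ = ≈-sym (inverseʳ-unique s₀ s₀ (≈-trans (∙-congˡ (≈-sym (identityʳ s₀))) s₀-order-2))

  c≈x∙t⇒x∙c⁻¹≈t⁻¹ : ∀ {x c t} → c ≈ x ∙ t → x ∙ c ⁻¹ ≈ t ⁻¹
  c≈x∙t⇒x∙c⁻¹≈t⁻¹ {x} {c} {t} c≈x∙t = begin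
    x ∙ c ⁻¹              ≈⟨ ∙-congˡ (⁻¹-cong c≈x∙t) ⟩
    x ∙ (x ∙ t) ⁻¹        ≈⟨ ∙-congˡ (⁻¹-∙-comm x t) ⟨
    x ∙ (x ⁻¹ ∙ t ⁻¹)     ≈⟨ \\-leftDividesˡ x (t ⁻¹) ⟩
    t ⁻¹                  ∎
    where open ≈-Reasoning

  x∙c⁻¹≈g⇒c≈x∙g⁻¹ : ∀ {x c g} → x ∙ c ⁻¹ ≈ g → c ≈ x ∙ g ⁻¹
  x∙c⁻¹≈g⇒c≈x∙g⁻¹ {x} {c} {g} x∙c⁻¹≈g = begin
    c                     ≈⟨ //-rightDividesˡ x c ⟨
    (c ∙ x ⁻¹) ∙ x        ≈⟨ comm _ x ⟩
    x ∙ (c ∙ x ⁻¹)        ≈⟨ ∙-congˡ (⁻¹-anti-homo‿- x c) ⟨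
    x ∙ (x ∙ c ⁻¹) ⁻¹     ≈⟨ ∙-congˡ (⁻¹-cong x∙c⁻¹≈g) ⟩
    x ∙ g ⁻¹              ∎
    where open ≈-Reasoning

  close-step : ∀ {x c} m → c ≈ x ∙ step m → Close G s s' s₀ x c
  close-step {x} stay c≈x∙ε = inj₁ (≈-sym (≈-trans c≈x∙ε (identityʳ x)))
  close-step +s  c≈ = inj₂ (inj₂ (inj₁ (c≈x∙t⇒x∙c⁻¹≈t⁻¹ c≈)))
  close-step -s  c≈ = inj₂ (inj₁ (≈-trans (c≈x∙t⇒x∙c⁻¹≈t⁻¹ c≈) (⁻¹-involutive s)))
  close-step +s' c≈ = inj₂ (inj₂ (inj₂ (inj₂ (inj₁ (c≈x∙t⇒x∙c⁻¹≈t⁻¹ c≈)))))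
  close-step -s' c≈ = inj₂ (inj₂ (inj₂ (inj₁ (≈-trans (c≈x∙t⇒x∙c⁻¹≈t⁻¹ c≈) (⁻¹-involutive s')))))
  close-step +s₀ c≈ = inj₂ (inj₂ (inj₂ (inj₂ (inj₂ (≈-trans (c≈x∙t⇒x∙c⁻¹≈t⁻¹ c≈) s₀⁻¹≈s₀)))))

  close⇒step : ∀ {x c} → Close G s s' s₀ x c → ∃ λ m → c ≈ x ∙ step m
  close⇒step {x} (inj₁ x≈c) = stay , ≈-sym (≈-trans (identityʳ x) x≈c)
  close⇒step (inj₂ (inj₁ e))                         = -s  , x∙c⁻¹≈g⇒c≈x∙g⁻¹ e
  close⇒step (inj₂ (inj₂ (inj₁ e)))                  = +s  , ≈-trans (x∙c⁻¹≈g⇒c≈x∙g⁻¹ e) (∙-congˡ (⁻¹-involutive s))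
  close⇒step (inj₂ (inj₂ (inj₂ (inj₁ e))))           = -s' , x∙c⁻¹≈g⇒c≈x∙g⁻¹ e
  close⇒step (inj₂ (inj₂ (inj₂ (inj₂ (inj₁ e)))))    = +s' , ≈-trans (x∙c⁻¹≈g⇒c≈x∙g⁻¹ e) (∙-congˡ (⁻¹-involutive s'))
  close⇒step (inj₂ (inj₂ (inj₂ (inj₂ (inj₂ e)))))    = +s₀ , ≈-trans (x∙c⁻¹≈g⇒c≈x∙g⁻¹ e) (∙-congˡ s₀⁻¹≈s₀)

  P : ℤ³ → Set
  P v = D (φ v)

  codeword-near : ∀ v → ∃ λ m → P (move m v)
  codeword-near v with proj₁ (perfect (φ v))
  ... | c , c∈D , close with close⇒step close
  ...   | m , c≈ = m , D-resp (≈-trans c≈ (≈-sym (φ-move m v))) c∈D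

  codewords-agree : ∀ v m m' → P (move m v) → P (move m' v) → step m ≈ step m'
  codewords-agree v m m' p p' = ∙-cancelˡ (φ v) _ _ (begin
    φ v ∙ step m     ≈⟨ φ-move m v ⟨
    φ (move m v)     ≈⟨ proj₂ (perfect (φ v)) _ _ p (close-step m (φ-move m v)) p' (close-step m' (φ-move m' v)) ⟩
    φ (move m' v)    ≈⟨ φ-move m' v ⟩
    φ v ∙ step m'    ∎)
    where open ≈-Reasoning

  codeword-exists : ∃ P
  codeword-exists with codeword-near (+ 0 , + 0 , + 0)
  ... | m , p = move m (+ 0 , + 0 , + 0) , p

  Period : ℤ³ → Set
  Period v = ∀ w → P w ⇔ P (w ⊕ v)

  period-⊕ : ∀ {u v} → Period u → Period v → Period (u ⊕ v)
  period-⊕ {u} {v} u-period v-period w = begin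
    P w              ≈⟨ u-period w ⟩
    P (w ⊕ u)        ≈⟨ v-period (w ⊕ u) ⟩
    P (w ⊕ u ⊕ v)    ≡⟨ cong P (⊕-assoc w u v) ⟩
    P (w ⊕ (u ⊕ v))  ∎
    where open ⇔-Reasoning

  period-+⊙ : ∀ {v} → Period v → ∀ n → Period (+ n ⊙ v)
  period-+⊙ {v} v-period zero    w = begin
    P w                           ≡⟨ cong P (⊕-identityʳ w) ⟨
    P (w ⊕ (+ 0 , + 0 , + 0))     ∎
    where open ⇔-Reasoning
  period-+⊙ {v} v-period (suc n) =
    subst Period (sym (⊙-suc n v)) (period-⊕ v-period (period-+⊙ v-period n))

  period-⊙ : ∀ {v} → Period v → ∀ n → Period (n ⊙ v)
  period-⊙ v-period (+ n)         = period-+⊙ v-period n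
  period-⊙ {v} v-period -[1+ n ]  w = begin
    P w                                   ≡⟨ cong P (⊕-⊙-neg-cancel w (+ suc n) v) ⟨
    P (w ⊕ -[1+ n ] ⊙ v ⊕ + suc n ⊙ v)    ≈⟨ period-+⊙ v-period (suc n) (w ⊕ -[1+ n ] ⊙ v) ⟨
    P (w ⊕ -[1+ n ] ⊙ v)                  ∎
    where open ⇔-Reasoning

  kernel-period : ∀ {v} → φ v ≈ ε → Period v
  kernel-period {v} φv≈ε w = mk⇔ (D-resp φw≈) (D-resp (≈-sym φw≈))
    where
    φw≈ : φ w ≈ φ (w ⊕ v)
    φw≈ = begin
      φ w          ≈⟨ identityʳ (φ w) ⟨
      φ w ∙ ε      ≈⟨ ∙-congˡ φv≈ε ⟨
      φ w ∙ φ v    ≈⟨ φ-homo w v ⟨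
      φ (w ⊕ v)    ∎
      where open ≈-Reasoning

  s-order-period : ∀ {o} → _×ℕ_ G o s ≈ ε → Period (+ o , + 0 , + 0)
  s-order-period os≈ε = kernel-period (≈-trans (identityʳ _) (≈-trans (identityʳ _) os≈ε))

  s'-order-period : ∀ {o} → _×ℕ_ G o s' ≈ ε → Period (+ 0 , + o , + 0)
  s'-order-period os'≈ε = kernel-period (≈-trans (identityʳ _) (≈-trans (identityˡ _) os'≈ε))

  step-not-period : ∀ m → ¬ step m ≈ ε → ¬ Period (vec m)
  step-not-period m step≉ε m-period with codeword-exists
  ... | w , p = step≉ε (≈-sym (codewords-agree w stay m p
                  (subst P (sym (move≡⊕vec m w)) (Equivalence.to (m-period w) p))))

±1*±1≡1 : ∀ {a} → a ≡ + 1 ⊎ a ≡ - + 1 → a * a ≡ + 1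
±1*±1≡1 (inj₁ refl) = refl
±1*±1≡1 (inj₂ refl) = refl

module Translation (G : AbelianGroup 0ℓ 0ℓ) (s s' s₀ : AbelianGroup.Carrier G)
  (s₀-order-2 : AbelianGroup._≈_ G (_×ℕ_ G 2 s₀) (AbelianGroup.ε G))
  (D : AbelianGroup.Carrier G → Set) (D-resp : RespectsEq G D) (perfect : IsPerfectCode G s s' s₀ D)
  (a : ℤ) (a≡±1 : a ≡ + 1 ⊎ a ≡ - + 1)
  (invariant : ∀ i j k → D (xv G s s' s₀ i j k) → D (xv G s s' s₀ (i + a) (j + + 1) (k + + 1)))
  where
  open AbelianGroup G using (_≈_; ε; _⁻¹; ∙-congˡ; ∙-cong; identityʳ) renaming (sym to ≈-sym; trans to ≈-trans)
  open PerfectCode G s s' s₀ s₀-order-2 D D-resp perfect public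

  a*a≡1 : a * a ≡ + 1
  a*a≡1 = ±1*±1≡1 a≡±1

  τ : ℤ³
  τ = (a , + 1 , + 1)

  translate : ∀ w → P w → P (w ⊕ τ)
  translate (i , j , k) = invariant i j k

  -- The codeword next to w, moved by τ, lies next to w ⊕ τ, so by perfectness it is w ⊕ τ itself.
  untranslate : ∀ w → P (w ⊕ τ) → P w
  untranslate w p with codeword-near w
  ... | m , q = D-resp φ-move≈φ q
    where
    ε≈step : ε ≈ step m
    ε≈step = codewords-agree (w ⊕ τ) stay m p (subst P (move-⊕ m w τ) (translate (move m w) q))
    φ-move≈φ : φ (move m w) ≈ φ w
    φ-move≈φ = ≈-trans (φ-move m w) (≈-trans (∙-congˡ (≈-sym ε≈step)) (identityʳ (φ w)))

  τ-period : Period τ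
  τ-period w = mk⇔ (translate w) (untranslate w)

  υ : ℤ³
  υ = (+ 1 , a , a)

  υ-period : Period υ
  υ-period = subst Period a⊙τ≡υ (period-⊙ τ-period a)
    where
    a⊙τ≡υ : a ⊙ τ ≡ υ
    a⊙τ≡υ = triple-≡ a*a≡1 (ℤ.*-identityʳ a) (ℤ.*-identityʳ a)

  col ht : ℤ³ → ℤ
  col (i , j , k) = j - a * i
  ht  (i , j , k) = k - a * i

  col-⊕ : ∀ v w → col (v ⊕ w) ≡ col v + col w
  col-⊕ (i , j , _) (i' , j' , _) = distrib i j i' j' a
    where
    distrib : ∀ i j i' j' a → (j + j') - a * (i + i') ≡ (j - a * i) + (j' - a * i')
    distrib = solve-∀

  normal-form : ∀ v → v ⊕ (- proj₁ v) ⊙ υ ≡ (+ 0 , col v , ht v)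
  normal-form (i , j , k) = triple-≡ (i-i≡0 i) (shear i j a) (shear i k a)
    where
    i-i≡0 : ∀ i → i + - i * + 1 ≡ + 0
    i-i≡0 = solve-∀
    shear : ∀ i j a → j + - i * a ≡ j - a * i
    shear = solve-∀

  period-normal-form : ∀ {v} → Period v → Period (+ 0 , col v , ht v)
  period-normal-form {v} v-period = subst Period (normal-form v) (period-⊕ v-period (period-⊙ υ-period (- proj₁ v)))

  normalise : ∀ v → P v → P (+ 0 , col v , ht v)
  normalise v p = subst P (normal-form v) (Equivalence.to (period-⊙ υ-period (- proj₁ v) v) p)

  vertical-period : Period (+ 0 , + 0 , + 2)
  vertical-period = kernel-period (≈-trans (∙-cong (identityʳ ε) s₀-order-2) (identityʳ ε))

  lower : ∀ {x q q'} r δ → q' - q ≡ δ + (r + r) → P (+ 0 , x , q') → P (+ 0 , x , q + δ)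
  lower {x} {q} {q'} r δ q'-q≡ p =
    subst P (triple-≡ (0+0≡0 r) (x+0≡x x r) lowered) (Equivalence.to (period-⊙ vertical-period (- r) (+ 0 , x , q')) p)
    where
    0+0≡0 : ∀ r → + 0 + - r * + 0 ≡ + 0
    0+0≡0 = solve-∀
    x+0≡x : ∀ x r → x + - r * + 0 ≡ x
    x+0≡x = solve-∀
    lowered : q' + - r * + 2 ≡ q + δ
    lowered = begin
      q' + - r * + 2                ≡⟨ rearrange q q' r ⟩
      q + (q' - q - (r + r))        ≡⟨ cong (λ d → q + (d - (r + r))) q'-q≡ ⟩
      q + (δ + (r + r) - (r + r))   ≡⟨ cancel q δ r ⟩
      q + δ                         ∎
      where
      open ≡-Reasoning
      rearrange : ∀ q q' r → q' + - r * + 2 ≡ q + (q' - q - (r + r))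
      rearrange = solve-∀
      cancel : ∀ q δ r → q + (δ + (r + r) - (r + r)) ≡ q + δ
      cancel = solve-∀

  realign : ∀ {x q'} q → P (+ 0 , x , q') → P (+ 0 , x , q) ⊎ P (+ 0 , x , q + + 1)
  realign {x} {q'} q p with parity (q' - q)
  ... | r , inj₁ even = inj₁ (subst (λ h → P (+ 0 , x , h)) (ℤ.+-identityʳ q)
                          (lower {x} {q} {q'} r (+ 0) (trans even (sym (ℤ.+-identityˡ (r + r)))) p))
  ... | r , inj₂ odd  = inj₂ (lower {x} {q} {q'} r (+ 1) odd p)

  x+1-1≡x : ∀ x → x + + 1 - + 1 ≡ x
  x+1-1≡x = solve-∀

  Occupied : ℤ → Set
  Occupied x = ∃ λ q → P (+ 0 , x , q)

  occupied-col : ∀ v {y} → P v → col v ≡ y → Occupied y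
  occupied-col v p refl = ht v , normalise v p

  cover : ∀ x → Occupied (x + + 1) ⊎ Occupied (x + + 2) ⊎ Occupied (x + + 3)
  cover x = from-move (codeword-near c)
    where
    c : ℤ³
    c = (+ 0 , x + + 2 , + 0)
    Goal : Set
    Goal = Occupied (x + + 1) ⊎ Occupied (x + + 2) ⊎ Occupied (x + + 3)
    col-c : ∀ x a → x + + 2 - a * + 0 ≡ x + + 2
    col-c = solve-∀
    col-c+1 : ∀ x a → x + + 2 + + 1 - a * + 0 ≡ x + + 3
    col-c+1 = solve-∀
    col-c-1 : ∀ x a → x + + 2 - + 1 - a * + 0 ≡ x + + 1
    col-c-1 = solve-∀
    from-+s : a ≡ + 1 ⊎ a ≡ - + 1 → P (move +s c) → Goal
    from-+s (inj₁ refl) p = inj₁ (occupied-col (move +s c) p (col≡ x))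
      where
      col≡ : ∀ x → x + + 2 - + 1 * + 1 ≡ x + + 1
      col≡ = solve-∀
    from-+s (inj₂ refl) p = inj₂ (inj₂ (occupied-col (move +s c) p (col≡ x)))
      where
      col≡ : ∀ x → x + + 2 - - + 1 * + 1 ≡ x + + 3
      col≡ = solve-∀
    from--s : a ≡ + 1 ⊎ a ≡ - + 1 → P (move -s c) → Goal
    from--s (inj₁ refl) p = inj₂ (inj₂ (occupied-col (move -s c) p (col≡ x)))
      where
      col≡ : ∀ x → x + + 2 - + 1 * - + 1 ≡ x + + 3
      col≡ = solve-∀
    from--s (inj₂ refl) p = inj₁ (occupied-col (move -s c) p (col≡ x))
      where
      col≡ : ∀ x → x + + 2 - - + 1 * - + 1 ≡ x + + 1
      col≡ = solve-∀
    from-move : ∃ (λ m → P (move m c)) → Goal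
    from-move (stay , p) = inj₂ (inj₁ (occupied-col c p (col-c x a)))
    from-move (+s   , p) = from-+s a≡±1 p
    from-move (-s   , p) = from--s a≡±1 p
    from-move (+s'  , p) = inj₂ (inj₂ (occupied-col (move +s' c) p (col-c+1 x a)))
    from-move (-s'  , p) = inj₁ (occupied-col (move -s' c) p (col-c-1 x a))
    from-move (+s₀  , p) = inj₂ (inj₁ (occupied-col (move +s₀ c) p (col-c x a)))

  module _ (s'≉ε : ¬ s' ≈ ε) (s'⁻¹≉s₀ : ¬ s' ⁻¹ ≈ s₀) (s'≉s'⁻¹ : ¬ s' ≈ s' ⁻¹)
           (s⁻¹≉s'⁻¹ : ¬ s ⁻¹ ≈ s' ⁻¹) (s≉s'⁻¹ : ¬ s ≈ s' ⁻¹) where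

    gap₁ : ∀ x → Occupied x → ¬ Occupied (x + + 1)
    gap₁ x (q , p) (q' , p') = from-realign (realign {x + + 1} {q'} q p')
      where
      from-realign : P (+ 0 , x + + 1 , q) ⊎ P (+ 0 , x + + 1 , q + + 1) → ⊥
      from-realign (inj₁ p₁) = s'≉ε (≈-sym (codewords-agree (+ 0 , x , q) stay +s' p p₁))
      from-realign (inj₂ p₁) = s'⁻¹≉s₀ (codewords-agree (+ 0 , x + + 1 , q) -s' +s₀ p-s' p₁)
        where
        p-s' : P (move -s' (+ 0 , x + + 1 , q))
        p-s' = subst (λ j → P (+ 0 , j , q)) (sym (x+1-1≡x x)) p

    gap₂ : ∀ x → Occupied x → ¬ Occupied (x + + 2)
    gap₂ x (q , p) (q' , p') = from-realign (realign {x + + 2} {q'} q p')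
      where
      c : ℤ³
      c = (+ 0 , x + + 1 , q)
      p-s' : P (move -s' c)
      p-s' = subst (λ j → P (+ 0 , j , q)) (sym (x+1-1≡x x)) p
      x+2≡x+1+1 : x + + 2 ≡ x + + 1 + + 1
      x+2≡x+1+1 = sym (ℤ.+-assoc x (+ 1) (+ 1))
      -- undoing τ turns (0, x + 2, q + 1) into w, the neighbour of c along -a s
      w : ℤ³
      w = (- a , x + + 1 , q)
      w⊕τ≡ : w ⊕ τ ≡ (+ 0 , x + + 2 , q + + 1)
      w⊕τ≡ = triple-≡ (ℤ.+-inverseˡ a) (sym x+2≡x+1+1) refl
      from-sign : a ≡ + 1 ⊎ a ≡ - + 1 → P w → ⊥
      from-sign (inj₁ refl) p-s = s⁻¹≉s'⁻¹ (≈-sym (codewords-agree c -s' -s p-s' p-s))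
      from-sign (inj₂ refl) p+s = s≉s'⁻¹ (≈-sym (codewords-agree c -s' +s p-s' p+s))
      from-realign : P (+ 0 , x + + 2 , q) ⊎ P (+ 0 , x + + 2 , q + + 1) → ⊥
      from-realign (inj₁ p₂) = s'≉s'⁻¹ (≈-sym (codewords-agree c -s' +s' p-s' (subst (λ j → P (+ 0 , j , q)) x+2≡x+1+1 p₂)))
      from-realign (inj₂ p₂) = from-sign a≡±1 (untranslate w (subst P (sym w⊕τ≡) p₂))

    period-col : ∀ {p} → Period p → + 3 Signed.∣ col p
    period-col {p} p-period with codeword-exists
    ... | w , pw = mod3-spacing Occupied gap₁ gap₂ cover (col w) (col p)
                     (occupied-col w pw refl)
                     (occupied-col (w ⊕ p) (Equivalence.to (p-period w) pw) (col-⊕ w p))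

  module _ (s₀≉ε : ¬ s₀ ≈ ε) where

    period-ht : ∀ {p} → Period p → col p ≡ + 0 → ¬ Odd (ht p)
    period-ht {p} p-period col≡0 (r , ht≡) =
      step-not-period +s₀ s₀≉ε (subst Period lowered (period-⊕ (period-normal-form p-period) (period-⊙ vertical-period (- r))))
      where
      zero-col : ∀ r → + 0 + - r * + 0 ≡ + 0
      zero-col = solve-∀
      lowered : (+ 0 , col p , ht p) ⊕ (- r) ⊙ (+ 0 , + 0 , + 2) ≡ vec +s₀
      lowered = triple-≡ (zero-col r) (trans (cong (_+ - r * + 0) col≡0) (zero-col r)) (trans (cong (_+ - r * + 2) ht≡) (odd-lower r))
        where
        odd-lower : ∀ r → + 1 + (r + r) + - r * + 2 ≡ + 1
        odd-lower = solve-∀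

    order-bound-s : ∀ {q₁ q₂ q₃} o → Period (q₁ , q₂ , q₃) → Odd (q₂ - q₃) → Period (+ o , + 0 , + 0) →
      ∀ e A → o ≡ 2 ^ e ℕ.* A → Odd (+ A) → ¬ (+ (2 ^ e) Signed.∣ col (q₁ , q₂ , q₃))
    order-bound-s {q₁} {q₂} {q₃} o q-period q-odd o-period e A o≡ A-odd (divides y col≡) =
      period-ht p-period col-p≡0 (subst Odd (sym ht-p≡) (odd-* A-odd q-odd))
      where
      open ≡-Reasoning
      E c : ℤ
      E = + (2 ^ e)
      c = - (a * y)
      p : ℤ³
      p = (- + A) ⊙ (q₁ , q₂ , q₃) ⊕ c ⊙ (+ o , + 0 , + 0)
      p-period : Period p
      p-period = period-⊕ (period-⊙ q-period (- + A)) (period-⊙ o-period c)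
      o≡E*A : + o ≡ E * + A
      o≡E*A = trans (cong +_ o≡) (ℤ.pos-* (2 ^ e) A)
      a²yo≡yEA : (a * a) * (y * + o) ≡ y * (E * + A)
      a²yo≡yEA = trans (cong₂ (λ u v → u * (y * v)) a*a≡1 o≡E*A) (ℤ.*-identityˡ _)
      col-p≡0 : col p ≡ + 0
      col-p≡0 = begin
        col p                                            ≡⟨ expand (+ A) q₁ q₂ a y (+ o) ⟩
        - + A * (q₂ - a * q₁) + (a * a) * (y * + o)      ≡⟨ cong₂ (λ u v → - + A * u + v) col≡ a²yo≡yEA ⟩
        - + A * (y * E) + y * (E * + A)                  ≡⟨ cancel (+ A) y E ⟩
        + 0                                              ∎
        where
        expand : ∀ A q₁ q₂ a y O → (- A * q₂ + - (a * y) * + 0) - a * (- A * q₁ + - (a * y) * O)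
                                   ≡ - A * (q₂ - a * q₁) + (a * a) * (y * O)
        expand = solve-∀
        cancel : ∀ A y E → - A * (y * E) + y * (E * A) ≡ + 0
        cancel = solve-∀
      ht-p≡ : ht p ≡ + A * (q₂ - q₃)
      ht-p≡ = begin
        ht p                                                      ≡⟨ expand (+ A) q₁ q₂ q₃ a y (+ o) ⟩
        + A * (q₂ - q₃) - + A * (q₂ - a * q₁) + (a * a) * (y * + o) ≡⟨ cong₂ (λ u v → + A * (q₂ - q₃) - + A * u + v) col≡ a²yo≡yEA ⟩
        + A * (q₂ - q₃) - + A * (y * E) + y * (E * + A)             ≡⟨ cancel (+ A) (q₂ - q₃) y E ⟩
        + A * (q₂ - q₃)                                           ∎
        where
        expand : ∀ A q₁ q₂ q₃ a y O → (- A * q₃ + - (a * y) * + 0) - a * (- A * q₁ + - (a * y) * O)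
                                      ≡ A * (q₂ - q₃) - A * (q₂ - a * q₁) + (a * a) * (y * O)
        expand = solve-∀
        cancel : ∀ A d y E → A * d - A * (y * E) + y * (E * A) ≡ A * d
        cancel = solve-∀

    order-bound-s' : ∀ {q₁ q₂ q₃} o → Period (q₁ , q₂ , q₃) → Odd (ht (q₁ , q₂ , q₃)) → Period (+ 0 , + o , + 0) →
      ∀ e B → o ≡ 2 ^ e ℕ.* B → Odd (+ B) → ¬ (+ (2 ^ e) Signed.∣ col (q₁ , q₂ , q₃))
    order-bound-s' {q₁} {q₂} {q₃} o q-period q-odd o-period e B o≡ B-odd (divides y col≡) =
      period-ht p-period col-p≡0 (subst Odd (sym (ht-p≡ (+ B) q₁ q₃ a y)) (odd-* B-odd q-odd))
      where
      open ≡-Reasoning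
      E : ℤ
      E = + (2 ^ e)
      p : ℤ³
      p = + B ⊙ (q₁ , q₂ , q₃) ⊕ (- y) ⊙ (+ 0 , + o , + 0)
      p-period : Period p
      p-period = period-⊕ (period-⊙ q-period (+ B)) (period-⊙ o-period (- y))
      col-p≡0 : col p ≡ + 0
      col-p≡0 = begin
        col p                                  ≡⟨ expand (+ B) q₁ q₂ a y (+ o) ⟩
        + B * (q₂ - a * q₁) - y * + o          ≡⟨ cong₂ (λ u v → + B * u - y * v) col≡ (trans (cong +_ o≡) (ℤ.pos-* (2 ^ e) B)) ⟩
        + B * (y * E) - y * (E * + B)          ≡⟨ cancel (+ B) y E ⟩
        + 0                                    ∎
        where
        expand : ∀ B q₁ q₂ a y O → (B * q₂ + - y * O) - a * (B * q₁ + - y * + 0) ≡ B * (q₂ - a * q₁) - y * O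
        expand = solve-∀
        cancel : ∀ B y E → B * (y * E) - y * (E * B) ≡ + 0
        cancel = solve-∀
      ht-p≡ : ∀ B q₁ q₃ a y → (B * q₃ + - y * + 0) - a * (B * q₁ + - y * + 0) ≡ B * (q₃ - a * q₁)
      ht-p≡ = solve-∀

lemma3p6 : (G : AbelianGroup 0ℓ 0ℓ) → IsFinite G →
  (s s' s₀ : El G) →
  -- S ⊆ G ∖ {0}
  ¬ (Eq G s (zer G)) → ¬ (Eq G (neg G s) (zer G)) → ¬ (Eq G s' (zer G)) → ¬ (Eq G (neg G s') (zer G)) → ¬ (Eq G s₀ (zer G)) →
  -- |S| = 5: the five listed elements are pairwise distinct
  ¬ (Eq G s (neg G s)) → ¬ (Eq G s s') → ¬ (Eq G s (neg G s')) → ¬ (Eq G s s₀) →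
  ¬ (Eq G (neg G s) s') → ¬ (Eq G (neg G s) (neg G s')) → ¬ (Eq G (neg G s) s₀) →
  ¬ (Eq G s' (neg G s')) → ¬ (Eq G s' s₀) → ¬ (Eq G (neg G s') s₀) →
  Generates G s s' s₀ →
  (os os' : ℕ) → IsOrder G s os → IsOrder G s' os' →
  IsOrder G s₀ 2 → 2 Data.Nat.< os → 2 Data.Nat.< os' →
  (a : ℤ) → (a ≡ + 1 ⊎ a ≡ - + 1) →
  (h l : ℕ) → h ≤ os → l ≤ os' →
  Eq G (xv G s s' s₀ (+ 0) (+ 0) (+ 0)) (xv G s s' s₀ (+ h) (+ l) (+ 0)) →
  (D : El G → Set) → RespectsEq G D → IsPerfectCode G s s' s₀ D →
  (∀ i j k → D (xv G s s' s₀ i j k) → D (xv G s s' s₀ (i + a) (j + + 1) (k + + 1))) →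
  ((+ 3) ∣ ((+ l) - a * (+ h)))
  × (σ (+ h) ≡ fin 0 → σ (+ l) ≡ fin 0 →
       (σ ((+ l) - a * (+ h)) <∞ σ (+ os)) × (σ ((+ l) - a * (+ h)) <∞ σ (+ os')))
lemma3p6 G _ s s' s₀ _ _ s'≉ε _ s₀≉ε _ _ s≉s'⁻¹ _ _ s⁻¹≉s'⁻¹ _ s'≉s'⁻¹ _ s'⁻¹≉s₀ _
         os os' s-order s'-order s₀-order 2<os 2<os' a a≡±1 h l _ _ x₀≈x[h,l,0] D D-resp perfect invariant =
  ∣⇒∣ᵤ (period-col s'≉ε s'⁻¹≉s₀ s'≉s'⁻¹ s⁻¹≉s'⁻¹ s≉s'⁻¹ hl-period) , valuation-bounds
  where
  open AbelianGroup G using () renaming (sym to ≈-sym; trans to ≈-trans)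
  open Translation G s s' s₀ (proj₁ (proj₂ s₀-order)) D D-resp perfect a a≡±1 invariant

  hl-period : Period (+ h , + l , + 0)
  hl-period = kernel-period (≈-trans (≈-sym x₀≈x[h,l,0]) (φ-vec stay))

  valuation-bounds : σ (+ h) ≡ fin 0 → σ (+ l) ≡ fin 0 →
    (σ (+ l - a * + h) <∞ σ (+ os)) × (σ (+ l - a * + h) <∞ σ (+ os'))
  valuation-bounds σh≡0 σl≡0 =
      ∤⇒σ<∞σ _ os (ℕ.<-trans ℕ.z<s 2<os) (order-bound-s s₀≉ε os hl-period l-odd (s-order-period (proj₁ (proj₂ s-order))))
    , ∤⇒σ<∞σ _ os' (ℕ.<-trans ℕ.z<s 2<os') (order-bound-s' s₀≉ε os' hl-period ah-odd (s'-order-period (proj₁ (proj₂ s'-order))))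
    where
    l-odd : Odd (+ l - + 0)
    l-odd = subst Odd (sym (ℤ.+-identityʳ (+ l))) (σ≡0⇒odd l σl≡0)
    ah-odd : Odd (+ 0 - a * + h)
    ah-odd = subst Odd (sym (ℤ.+-identityˡ _)) (odd-neg (odd-* (±1-odd a≡±1) (σ≡0⇒odd h σh≡0)))
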